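{- Let $S$ be a finite transformation semigroup which is a semilattice, let $I$ be its minimal ideal, and let $b_1,\dots,b_s$ generate $I$ as a semigroup. Then $\mathrm{Gr}(S)=\mathrm{Gr}(\{b_1\})$.
   Context: A semilattice is a commutative semigroup in which every element is idempotent. The minimal ideal is the unique minimal two-sided ideal. Transformations act on the right. For a set $M$ of transformations of a finite set $V$, $\mathrm{Gr}(M)$ is the graph on $V$ in which distinct $v,w$ are adjacent iff there is no $f\in M$ with $vf=wf$. -}

module Defs where

open import Data.Nat using (ℕ)
open import Data.Fin using (Fin)
open import Data.List.NonEmpty using (List⁺; _∷_)
open import Data.List using (List; []; _∷_)
open import Data.Product using (Σ; ∃; _×_; _,_)
open import Relation.Nullary using (¬_)
open import Relation.Binary.PropositionalEquality using (_≡_; _≗_)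
open import Function using (_∘_)

Trans : ℕ → Set
Trans n = Fin n → Fin n

TSet : ℕ → Set₁
TSet n = Trans n → Set

-- Transformations act on the right: v (f · g) = (v f) g
_·_ : ∀ {n} → Trans n → Trans n → Trans n
f · g = g ∘ f

-- A subset is a set of transformations: closed under pointwise equality
-- (we have no function extensionality)
Respects≗ : ∀ {n} → TSet n → Set
Respects≗ A = ∀ {f g} → A f → f ≗ g → A g

_⊆_ : ∀ {n} → TSet n → TSet n → Set
A ⊆ B = ∀ {f} → A f → B f

record IsTransSemigroup {n} (S : TSet n) : Set where
  field
    respects : Respects≗ S
    closed   : ∀ {f g} → S f → S g → S (f · g)

record IsSemilattice {n} (S : TSet n) : Set where
  field
    comm : ∀ {f g} → S f → S g → (f · g) ≗ (g · f)
    idem : ∀ {f} → S f → (f · f) ≗ f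

record IsIdeal {n} (S J : TSet n) : Set where
  field
    respects : Respects≗ J
    sub      : J ⊆ S
    nonempty : ∃ J
    right    : ∀ {f g} → J f → S g → J (f · g)
    left     : ∀ {f g} → S g → J f → J (g · f)

record IsMinimalIdeal {n} (S I : TSet n) : Set₁ where
  field
    ideal   : IsIdeal S I
    minimal : ∀ (J : TSet n) → IsIdeal S J → J ⊆ I → I ⊆ J

evalList : ∀ {n k} → (Fin k → Trans n) → Trans n → List (Fin k) → Trans n
evalList b acc []       = acc
evalList b acc (i ∷ is) = evalList b (acc · b i) is

eval : ∀ {n k} → (Fin k → Trans n) → List⁺ (Fin k) → Trans n
eval b (i ∷ is) = evalList b (b i) is

Generates : ∀ {n k} → (Fin k → Trans n) → TSet n → Set
Generates b I =
  (∀ w → I (eval b w)) × (∀ {f} → I f → Σ (List⁺ _) λ w → f ≗ eval b w)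

GrAdj : ∀ {n} → TSet n → Fin n → Fin n → Set
GrAdj M v w = ¬ (v ≡ w) × ¬ (∃ λ f → M f × f v ≡ f w)

Single : ∀ {n} → Trans n → TSet n
Single b f = f ≗ b

module Submission where

-- Fix f ∈ S.  In a semilattice, the elements g of an ideal I
-- that are absorbed by f (f·g = g, i.e. vg = (vf)g for every point v) form
-- again an ideal of S, contained in I; when I is minimal it is all of I.
-- Hence every element b of the minimal ideal satisfies f·b = b for every
-- f ∈ S, so b identifies every pair of points that some f ∈ S identifies:
-- vf = wf implies vb = (vf)b = (wf)b = wb.
--
-- The graph Gr(M) shrinks when M grows, and conversely Gr(N) ⊆ Gr(M) as soon
-- as every kernel of an element of N is refined by a kernel of an element
-- of M.  Applying both facts with M = {b₁} and N = S (b₁ ∈ I ⊆ S because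
-- the generators lie in I) gives Gr(S) = Gr({b₁}).

open import Defs
open import Data.Nat using (ℕ; suc)
open import Data.Fin using (Fin; zero)
open import Function.Bundles using (_⇔_; mk⇔)
open import Data.Product using (∃; _×_; _,_; proj₁; proj₂)
open import Data.List.NonEmpty using (_∷_)
open import Data.List using ([])
open import Relation.Binary.PropositionalEquality

-- f absorbs g from the left: f·g = g, i.e. v g = (v f) g for every point v.
Absorbs : ∀ {n} → Trans n → Trans n → Set
Absorbs f g = ∀ x → g x ≡ g (f x)

AbsorbedIn : ∀ {n} → TSet n → Trans n → TSet n
AbsorbedIn I f g = I g × Absorbs f g

module _ {n} {S I : TSet n} (SL : IsSemilattice S) (ideal : IsIdeal S I) where
  open IsSemilattice SL
  open IsIdeal ideal

  -- For f ∈ S, the part of an ideal absorbed by f is again an ideal: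
  -- f·(f·b) = f·b gives an element, and commutativity of S lets left
  -- multiplication by h ∈ S commute past f.
  absorbed-isIdeal : ∀ {f} → S f → IsIdeal S (AbsorbedIn I f)
  absorbed-isIdeal {f} Sf = record
    { respects = λ { (Ig , fg) g≗h →
        respects Ig g≗h , λ x → trans (sym (g≗h x)) (trans (fg x) (g≗h (f x))) }
    ; sub      = λ (Ig , _) → sub Ig
    ; nonempty = let (b , Ib) = nonempty in
        f · b , left Sf Ib , λ x → cong b (sym (idem Sf x))
    ; right    = λ { {g} {h} (Ig , fg) Sh → right Ig Sh , λ x → cong h (fg x) }
    ; left     = λ { {g} {h} Sh (Ig , fg) →
        left Sh Ig , λ x → trans (fg (h x)) (cong g (sym (comm Sf Sh x))) }
    }

minimalIdeal-absorbed : ∀ {n} {S I : TSet n} → IsSemilattice S → IsMinimalIdeal S I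
  → ∀ {f b} → S f → I b → Absorbs f b
minimalIdeal-absorbed SL MI Sf Ib =
  proj₂ (minimal (AbsorbedIn _ _) (absorbed-isIdeal SL ideal Sf) proj₁ Ib)
  where open IsMinimalIdeal MI

KernelRefines : ∀ {n} → Trans n → Trans n → Set
KernelRefines f g = ∀ {v w} → f v ≡ f w → g v ≡ g w

absorbed-coarsens : ∀ {n} {f g : Trans n} → Absorbs f g → KernelRefines f g
absorbed-coarsens {f = f} {g} fg {v} {w} fv≡fw = begin
  g v     ≡⟨ fg v ⟩
  g (f v) ≡⟨ cong g fv≡fw ⟩
  g (f w) ≡⟨ fg w ⟨
  g w     ∎
  where open ≡-Reasoning

GrAdj-antitone : ∀ {n} {M N : TSet n} → M ⊆ N → ∀ {v w} → GrAdj N v w → GrAdj M v w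
GrAdj-antitone M⊆N (v≢w , noN) = v≢w , λ (f , Mf , eq) → noN (f , M⊆N Mf , eq)

GrAdj-dominated : ∀ {n} {M N : TSet n}
  → (∀ {f} → N f → ∃ λ g → M g × KernelRefines f g)
  → ∀ {v w} → GrAdj M v w → GrAdj N v w
GrAdj-dominated dom (v≢w , noM) =
  v≢w , λ (f , Nf , eq) → let (g , Mg , ker) = dom Nf in noM (g , Mg , ker eq)

mainTheorem17 : (n : ℕ) (S I : TSet n) → IsTransSemigroup S → IsSemilattice S
    → IsMinimalIdeal S I → (s : ℕ) (b : Fin (suc s) → Trans n) → Generates b I
    → (v w : Fin n) → GrAdj S v w ⇔ GrAdj (Single (b zero)) v w
mainTheorem17 n S I TS SL MI s b gen v w =
  mk⇔ (GrAdj-antitone single⊆S) (GrAdj-dominated b₁-dominates)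
  where
  Ib₁ : I (b zero)
  Ib₁ = proj₁ gen (zero ∷ [])

  single⊆S : Single (b zero) ⊆ S
  single⊆S g≗b = IsTransSemigroup.respects TS
    (IsIdeal.sub (IsMinimalIdeal.ideal MI) Ib₁) (λ x → sym (g≗b x))

  b₁-dominates : ∀ {f} → S f
    → ∃ λ g → Single (b zero) g × KernelRefines f g
  b₁-dominates Sf =
    b zero , (λ _ → refl) , absorbed-coarsens (minimalIdeal-absorbed SL MI Sf Ib₁)
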